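{- Let $k\ge 4$ and let $G$ be a mixed $k$-melon graph whose set of paths $\mathcal{P}=\mathcal{P}_{even}\cup\mathcal{P}_{odd}$ satisfies $|\mathcal{P}_{even}|\ge 2$ and $|\mathcal{P}_{odd}|\ge 2$. For $P_e\in\mathcal{P}_{even}$ and $\mathcal{S}_o\subseteq\mathcal{P}_{odd}$ let $U^{P_e}_{\mathcal{S}_o}$ be the vertex set such that $P_e$ is external, every path of $\mathcal{P}_{even}\setminus\{P_e\}$ is internal, every path of $\mathcal{S}_o$ is an $s$-path, and every path of $\mathcal{P}_{odd}\setminus\mathcal{S}_o$ is a $t$-path, all with respect to $U^{P_e}_{\mathcal{S}_o}$. Then $\mathrm{evc}(G)=\mathrm{vc}(G)+1$, and $\mathcal{U}=\{U^{P_e}_{\mathcal{S}_o} : P_e\in\mathcal{P}_{even},\ \emptyset\ne\mathcal{S}_o\subsetneq\mathcal{P}_{odd}\}$ is a minimum eternal vertex cover class of $G$.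
   Context: For $k\ge1$, a $k$-melon graph is the union of a set $\mathcal{P}$ of $k$ pairwise internally vertex-disjoint paths, each of length at least $1$, with the same two distinct endpoints $s$ and $t$. $\mathcal{P}_{even}$ and $\mathcal{P}_{odd}$ are the paths of even and odd length; $G$ is mixed if both are nonempty. For an even path $P$ with vertices $v_0,\dots,v_{2m}$, $\{v_0,v_{2m}\}=\{s,t\}$, and a vertex set $U$: $P$ is internal w.r.t. $U$ if $U\cap V(P)=\{v_{2j}:0\le j\le m\}$, external if $U\cap V(P)=\{v_{2j+1}:0\le j\le m-1\}\cup\{s,t\}$. For an odd path $P_o$ with vertices $v_0=t,\dots,v_{2m+1}=s$: $P_o$ is an $s$-path w.r.t. $U$ if $(U\cap V(P_o))\setminus\{t\}=\{v_{2i+1}:0\le i\le m\}$, a $t$-path if $(U\cap V(P_o))\setminus\{s\}=\{v_{2i}:0\le i\le m\}$. $\mathrm{vc}(G)$ is the vertex cover number. For a vertex cover $U$ of $G=(V,E)$ and an edge $e=vw$, a defense of $U$ against $e$ is a one-to-one map $\phi:U\to V$ with $\phi(u)\in N[u]$ (closed neighborhood) for all $u\in U$ and $\phi(v)=w$ (with $v\in U$) or $\phi(w)=v$ (with $w\in U$). An eternal vertex cover class is a family $\mathcal{U}$ of vertex covers of equal cardinality (its size) such that for every $U\in\mathcal{U}$ and every edge $e$ there is a defense $\phi$ of $U$ against $e$ with $\phi(U)\in\mathcal{U}$; $\mathrm{evc}(G)$ is the minimum size of such a class, and a class of that size is minimum. -}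

module Defs where

open import Level using (Level)
open import Data.Nat using (ℕ; zero; suc; _≤_; _∸_)
open import Data.Nat.Divisibility using (_∣_)
open import Data.Fin using (Fin; toℕ)
open import Data.Bool using (Bool; true; false; if_then_else_)
open import Data.List using (List; []; _∷_; map; concatMap; allFin)
open import Data.Product using (Σ; ∃; _×_; _,_)
open import Data.Sum using (_⊎_)
open import Relation.Nullary using (¬_)
open import Relation.Binary.PropositionalEquality using (_≡_; _≢_)
open import Function.Bundles using (_⇔_)

-- A finite graph: vertex type, adjacency relation and a list enumerating
-- every vertex exactly once (used to count the size of vertex sets).
record FinGraph : Set₁ where
  field
    V        : Set
    Adj      : V → V → Set
    vertices : List V

VSet : FinGraph → Set
VSet G = FinGraph.V G → Bool

count : {A : Set} → (A → Bool) → List A → ℕ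
count U []       = 0
count U (v ∷ vs) = if U v then suc (count U vs) else count U vs

∣_∣ₛ : {G : FinGraph} → VSet G → ℕ
∣_∣ₛ {G} U = count U (FinGraph.vertices G)

module _ (G : FinGraph) where
  open FinGraph G

  IsVertexCover : VSet G → Set
  IsVertexCover U = ∀ v w → Adj v w → U v ≡ true ⊎ U w ≡ true

  IsVCNumber : ℕ → Set
  IsVCNumber c =
    (Σ (VSet G) λ U → IsVertexCover U × ∣_∣ₛ {G} U ≡ c) ×
    (∀ U → IsVertexCover U → c ≤ ∣_∣ₛ {G} U)

  InClosedNbhd : V → V → Set
  InClosedNbhd u w = w ≡ u ⊎ Adj u w

  IsDefense : VSet G → V → V → (V → V) → Set
  IsDefense U v w φ =
    (∀ u → U u ≡ true → InClosedNbhd u (φ u)) ×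
    (∀ u u′ → U u ≡ true → U u′ ≡ true → φ u ≡ φ u′ → u ≡ u′) ×
    ((U v ≡ true × φ v ≡ w) ⊎ (U w ≡ true × φ w ≡ v))

  IsImage : VSet G → (V → V) → VSet G → Set
  IsImage U φ W = ∀ x → (W x ≡ true) ⇔ (Σ V λ u → U u ≡ true × φ u ≡ x)

  -- A family of vertex sets (a predicate on vertex sets, understood up to
  -- extensional equality) is an eternal vertex cover class of size m.
  IsEVCClass : (VSet G → Set) → ℕ → Set₁
  IsEVCClass 𝒰 m =
    Lift′ (Σ (VSet G) 𝒰) ×
    Lift′ (∀ U → 𝒰 U → IsVertexCover U × ∣_∣ₛ {G} U ≡ m) ×
    Lift′ (∀ U → 𝒰 U → ∀ v w → Adj v w →
       Σ (V → V) λ φ → IsDefense U v w φ ×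
         Σ (VSet G) λ W → 𝒰 W × IsImage U φ W)
    where
      Lift′ : Set → Set₁
      Lift′ = Level.Lift (Level.suc Level.zero)

  IsEVCNumber : ℕ → Set₁
  IsEVCNumber m =
    (Σ (VSet G → Set) λ 𝒰 → IsEVCClass 𝒰 m) ×
    (∀ 𝒰 m′ → IsEVCClass 𝒰 m′ → Level.Lift (Level.suc Level.zero) (m ≤ m′))

  IsMinimumEVCClass : (VSet G → Set) → ℕ → Set₁
  IsMinimumEVCClass 𝒰 m = IsEVCClass 𝒰 m × IsEVCNumber m

data MV (k : ℕ) (ℓ : Fin k → ℕ) : Set where
  s t   : MV k ℓ
  inner : (i : Fin k) → Fin (ℓ i ∸ 1) → MV k ℓ

-- At i p v : v is the vertex at position p on path i, counting from t
-- (position 0 is t, position ℓ i is s, inner i j is at position j+1).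
data At {k : ℕ} {ℓ : Fin k → ℕ} (i : Fin k) : ℕ → MV k ℓ → Set where
  at-t  : At i 0 t
  at-s  : At i (ℓ i) s
  at-in : (j : Fin (ℓ i ∸ 1)) → At i (suc (toℕ j)) (inner i j)

MelonAdj : (k : ℕ) (ℓ : Fin k → ℕ) → MV k ℓ → MV k ℓ → Set
MelonAdj k ℓ u w = Σ (Fin k) λ i → Σ ℕ λ p →
  (At i p u × At i (suc p) w) ⊎ (At i p w × At i (suc p) u)

melonVertices : (k : ℕ) (ℓ : Fin k → ℕ) → List (MV k ℓ)
melonVertices k ℓ =
  s ∷ t ∷ concatMap (λ i → map (inner i) (allFin (ℓ i ∸ 1))) (allFin k)

Melon : (k : ℕ) (ℓ : Fin k → ℕ) → FinGraph
Melon k ℓ = record { V = MV k ℓ ; Adj = MelonAdj k ℓ ; vertices = melonVertices k ℓ }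

Even Odd : ℕ → Set
Even p = 2 ∣ p
Odd p = ¬ (2 ∣ p)

module _ {k : ℕ} {ℓ : Fin k → ℕ} (U : MV k ℓ → Bool) where
  IsInternal : Fin k → Set
  IsInternal i = ∀ p v → At i p v → (U v ≡ true) ⇔ Even p

  IsExternal : Fin k → Set
  IsExternal i = ∀ p v → At i p v → (U v ≡ true) ⇔ (Odd p ⊎ v ≡ s ⊎ v ≡ t)

  IsSPath : Fin k → Set
  IsSPath i = ∀ p v → At i p v → v ≢ t → (U v ≡ true) ⇔ Odd p

  IsTPath : Fin k → Set
  IsTPath i = ∀ p v → At i p v → v ≢ s → (U v ≡ true) ⇔ Even p

-- U is the vertex set U^{P_e}_{S_o}, where e indexes P_e and S_o is the set
-- of odd paths i with So i ≡ true.
IsU : (k : ℕ) (ℓ : Fin k → ℕ) → Fin k → (Fin k → Bool) → (MV k ℓ → Bool) → Set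
IsU k ℓ e So U =
  IsExternal U e ×
  (∀ i → Even (ℓ i) → i ≢ e → IsInternal U i) ×
  (∀ i → Odd (ℓ i) → So i ≡ true → IsSPath U i) ×
  (∀ i → Odd (ℓ i) → So i ≡ false → IsTPath U i)

𝒰Family : (k : ℕ) (ℓ : Fin k → ℕ) → (MV k ℓ → Bool) → Set
𝒰Family k ℓ U =
  Σ (Fin k) λ e → Even (ℓ e) ×
  Σ (Fin k → Bool) λ So →
    (Σ (Fin k) λ i → Odd (ℓ i) × So i ≡ true) ×
    (Σ (Fin k) λ i → Odd (ℓ i) × So i ≡ false) ×
    IsU k ℓ e So U

{-# OPTIONS --safe #-}
module Submission where

-- Lower bound: on a path with n inner vertices each of the n + 1 edges needs a guarded end;
-- an inner vertex guards two of them and s or t one, so a vertex cover U contains at least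
-- ⌊(n + #({s, t} ∖ U))/2⌋ inner vertices of each path.  Summing, |U| ≥ 2 + Σ ⌊nᵢ/2⌋, with one
-- more if U misses s or t (the two even paths have odd nᵢ) or contains the first inner vertex x
-- of an even path.  After any defense against the edge t x the vertex x is guarded, so an
-- eternal class has size at least vc + 1.
--
-- Upper bound: describe U^{P_e}_{S_o} by the parity of the occupied positions on each path (its
-- phase); P_e is the only path carrying one guard more than a minimum cover needs.  If both ends
-- of the attacked edge are guarded the two guards swap; otherwise the guards rotate one step
-- around the even cycle formed by the attacked path and a path of the same parity and opposite
-- phase, which swaps the two phases and so stays in the family.

open import Defs hiding (At)
import Defs
open import Level using (lift)
open import Function using (_∘_; id; case_of_)
open import Function.Bundles using (_⇔_; mk⇔; module Equivalence)
import Function.Properties.Equivalence as ⇔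
open import Data.Bool using (Bool; true; false; not; if_then_else_)
open import Data.Nat using (ℕ; zero; suc; _+_; _∸_; _≤_; _<_; z≤n; s≤s; _<?_; ⌊_/2⌋; ⌈_/2⌉; parity)
open import Data.Nat.Properties hiding (_≟_)
open import Data.Nat.Divisibility using (_∣0; ∣-refl; ∣m∣n⇒∣m+n; ∣m+n∣m⇒∣n; >⇒∤)
open import Data.Parity.Base using (Parity; 0ℙ; 1ℙ; _⁻¹)
open import Data.Parity.Properties using (⁻¹-selfInverse; ⁻¹-involutive; suc-homo-⁻¹; p≢p⁻¹)
  renaming (_≟_ to _≟ℙ_)
open import Data.Fin using (Fin; zero; suc; toℕ; fromℕ<)
open import Data.Fin.Properties using (_≟_; toℕ<n; toℕ-fromℕ<; fromℕ<-toℕ)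
open import Data.Fin.Permutation as Perm using (Permutation′; _⟨$⟩ʳ_; _⟨$⟩ˡ_; inverseˡ; inverseʳ)
import Data.Fin.Permutation.Components as PC
open import Data.List using (List; []; _∷_; _++_; map; concatMap; tabulate; allFin)
open import Data.List.Properties using (map-tabulate)
open import Data.Product as Product using (Σ; _×_; _,_; proj₁; proj₂)
open import Data.Sum as Sum using (_⊎_; inj₁; inj₂; swap; [_,_]′)
open import Relation.Nullary using (Dec; does; yes; no; contradiction)
open import Relation.Nullary.Decidable using (dec-true; dec-false; decidable-stable)
open import Relation.Binary using (DecidableEquality)
open import Relation.Binary.PropositionalEquality
open import Algebra.Properties.CommutativeMonoid.Sum +-0-commutativeMonoid
  using (sum; sum-syntax; sum-cong-≗)
open import Algebra.Properties.CommutativeSemigroup +-commutativeSemigroup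
  using (x∙yz≈y∙xz)

𝟙 : Bool → ℕ
𝟙 b = if b then 1 else 0

𝟙-≤ : ∀ b → 𝟙 b ≤ 1
𝟙-≤ true  = ≤-refl
𝟙-≤ false = z≤n

+𝟙≤suc : ∀ m b → m + 𝟙 b ≤ suc m
+𝟙≤suc m b = subst (m + 𝟙 b ≤_) (+-comm m 1) (+-monoʳ-≤ m (𝟙-≤ b))

module _ {A : Set} (U : A → Bool) where

  count-∷ : ∀ x xs → count U (x ∷ xs) ≡ 𝟙 (U x) + count U xs
  count-∷ x xs with U x
  ... | true  = refl
  ... | false = refl

  count-++ : ∀ xs ys → count U (xs ++ ys) ≡ count U xs + count U ys
  count-++ []       ys = refl
  count-++ (x ∷ xs) ys = begin
    count U (x ∷ xs ++ ys)               ≡⟨ count-∷ x (xs ++ ys) ⟩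
    𝟙 (U x) + count U (xs ++ ys)         ≡⟨ cong (𝟙 (U x) +_) (count-++ xs ys) ⟩
    𝟙 (U x) + (count U xs + count U ys)  ≡⟨ +-assoc (𝟙 (U x)) _ _ ⟨
    𝟙 (U x) + count U xs + count U ys    ≡⟨ cong (_+ count U ys) (count-∷ x xs) ⟨
    count U (x ∷ xs) + count U ys        ∎
    where open ≡-Reasoning

  count-tabulate : ∀ {n} (f : Fin n → A) → count U (tabulate f) ≡ ∑[ i < n ] 𝟙 (U (f i))
  count-tabulate {zero}  f = refl
  count-tabulate {suc n} f =
    trans (count-∷ (f zero) (tabulate (f ∘ suc))) (cong (𝟙 (U (f zero)) +_) (count-tabulate (f ∘ suc)))

  count-concatMap : ∀ {B : Set} (g : B → List A) {n} (f : Fin n → B) →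
                    count U (concatMap g (tabulate f)) ≡ ∑[ i < n ] count U (g (f i))
  count-concatMap g {zero}  f = refl
  count-concatMap g {suc n} f =
    trans (count-++ (g (f zero)) _) (cong (count U (g (f zero)) +_) (count-concatMap g (f ∘ suc)))

count-cong : ∀ {A : Set} {U U′ : A → Bool} → U ≗ U′ → ∀ xs → count U xs ≡ count U′ xs
count-cong U≗U′ []       = refl
count-cong {U = U} {U′} U≗U′ (x ∷ xs) = begin
  count U (x ∷ xs)          ≡⟨ count-∷ U x xs ⟩
  𝟙 (U x) + count U xs      ≡⟨ cong₂ _+_ (cong 𝟙 (U≗U′ x)) (count-cong U≗U′ xs) ⟩
  𝟙 (U′ x) + count U′ xs    ≡⟨ count-∷ U′ x xs ⟨
  count U′ (x ∷ xs)         ∎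
  where open ≡-Reasoning

∑-mono-≤ : ∀ {n} {f g : Fin n → ℕ} → (∀ i → f i ≤ g i) → sum f ≤ sum g
∑-mono-≤ {zero}  f≤g = z≤n
∑-mono-≤ {suc n} f≤g = +-mono-≤ (f≤g zero) (∑-mono-≤ (f≤g ∘ suc))

∑-mono-< : ∀ {n} {f g : Fin n → ℕ} (e : Fin n) →
           (∀ i → f i ≤ g i) → f e < g e → suc (sum f) ≤ sum g
∑-mono-< zero    f≤g fe<ge = +-mono-≤ fe<ge (∑-mono-≤ (f≤g ∘ suc))
∑-mono-< {suc n} {f} {g} (suc e) f≤g fe<ge =
  subst (_≤ sum g) (+-suc (f zero) _) (+-mono-≤ (f≤g zero) (∑-mono-< e (f≤g ∘ suc) fe<ge))

∑-mono-<₂ : ∀ {n} {f g : Fin n → ℕ} (e₁ e₂ : Fin n) → e₁ ≢ e₂ →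
            (∀ i → f i ≤ g i) → f e₁ < g e₁ → f e₂ < g e₂ → 2 + sum f ≤ sum g
∑-mono-<₂ zero zero e₁≢e₂ _ _ _ = contradiction refl e₁≢e₂
∑-mono-<₂ {suc n} {f} {g} zero (suc e₂) _ f≤g f₁<g₁ f₂<g₂ =
  subst (_≤ sum g) (+-suc (suc (f zero)) _) (+-mono-≤ f₁<g₁ (∑-mono-< e₂ (f≤g ∘ suc) f₂<g₂))
∑-mono-<₂ {suc n} {f} {g} (suc e₁) zero _ f≤g f₁<g₁ f₂<g₂ =
  subst (_≤ sum g) (+-suc (suc (f zero)) _) (+-mono-≤ f₂<g₂ (∑-mono-< e₁ (f≤g ∘ suc) f₁<g₁))
∑-mono-<₂ {suc n} {f} {g} (suc e₁) (suc e₂) e₁≢e₂ f≤g f₁<g₁ f₂<g₂ =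
  subst (_≤ sum g) (trans (+-suc (f zero) _) (cong suc (+-suc (f zero) _)))
    (+-mono-≤ (f≤g zero) (∑-mono-<₂ e₁ e₂ (e₁≢e₂ ∘ cong suc) (f≤g ∘ suc) f₁<g₁ f₂<g₂))

∑-suc : ∀ {n} (f : Fin n → ℕ) → ∑[ i < n ] suc (f i) ≡ n + sum f
∑-suc {zero}  f = refl
∑-suc {suc n} f = cong suc (trans (cong (f zero +_) (∑-suc (f ∘ suc))) (x∙yz≈y∙xz (f zero) n _))

∑-bump : ∀ {n} {f g : Fin n → ℕ} (e : Fin n) →
         (∀ i → i ≢ e → g i ≡ f i) → g e ≡ suc (f e) → sum g ≡ suc (sum f)
∑-bump {suc n} zero g≡f gₑ≡ = cong₂ _+_ gₑ≡ (sum-cong-≗ λ i → g≡f (suc i) λ ())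
∑-bump {suc n} {f} (suc e) g≡f gₑ≡ =
  trans (cong₂ _+_ (g≡f zero λ ()) (∑-bump e (λ i i≢e → g≡f (suc i) λ { refl → i≢e refl }) gₑ≡))
        (+-suc (f zero) _)

⌊/2⌋-≤ : ∀ {m} c → m ≤ suc (c + c) → ⌊ m /2⌋ ≤ c
⌊/2⌋-≤ c m≤ = subst (⌊ _ /2⌋ ≤_) (sym (n≡⌈n+n/2⌉ c)) (⌊n/2⌋-mono m≤)

-- b p tells whether the vertex at position p of a path with n inner vertices is chosen.
path-cover-bound : ∀ n (b : ℕ → Bool) → (∀ p → p ≤ n → b p ≡ true ⊎ b (suc p) ≡ true) →
  let c = ∑[ j < n ] 𝟙 (b (suc (toℕ j))) in
  n + (𝟙 (not (b 0)) + 𝟙 (not (b (suc n)))) ≤ suc (c + c)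
path-cover-bound zero b covered with b 0 | b 1 | covered 0 z≤n
... | true  | true  | _ = z≤n
... | true  | false | _ = ≤-refl
... | false | true  | _ = ≤-refl
... | false | false | inj₁ ()
... | false | false | inj₂ ()
path-cover-bound (suc n) b covered =
  extend n (∑[ j < n ] 𝟙 (b (2 + toℕ j))) (𝟙 (not (b (2 + n)))) (b 0) (b 1) (covered 0 z≤n)
    (path-cover-bound n (b ∘ suc) (λ p p≤n → covered (suc p) (s≤s p≤n)))
  where
  extend : ∀ n c Z b₀ b₁ → b₀ ≡ true ⊎ b₁ ≡ true → n + (𝟙 (not b₁) + Z) ≤ suc (c + c) →
           suc n + (𝟙 (not b₀) + Z) ≤ suc ((𝟙 b₁ + c) + (𝟙 b₁ + c))
  extend n c Z b₀ true _ ih = begin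
    suc n + (𝟙 (not b₀) + Z)  ≤⟨ s≤s (+-monoʳ-≤ n (+-monoˡ-≤ Z (𝟙-≤ (not b₀)))) ⟩
    suc (n + suc Z)           ≡⟨ cong suc (+-suc n Z) ⟩
    suc (suc (n + Z))         ≤⟨ s≤s (s≤s ih) ⟩
    suc (suc (suc (c + c)))   ≡⟨ cong (λ x → suc (suc x)) (+-suc c c) ⟨
    suc (suc (c + suc c))     ∎
    where open ≤-Reasoning
  extend n c Z true  false _         ih = subst (_≤ suc (c + c)) (+-suc n Z) ih
  extend n c Z false false (inj₁ ()) _
  extend n c Z false false (inj₂ ()) _

⌈n/2⌉≡⌊n/2⌋ : ∀ n → parity n ≡ 0ℙ → ⌈ n /2⌉ ≡ ⌊ n /2⌋
⌈n/2⌉≡⌊n/2⌋ zero          _  = refl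
⌈n/2⌉≡⌊n/2⌋ (suc (suc n)) p₀ = cong suc (⌈n/2⌉≡⌊n/2⌋ n p₀)

⌈n/2⌉≡1+⌊n/2⌋ : ∀ n → parity n ≡ 1ℙ → ⌈ n /2⌉ ≡ suc ⌊ n /2⌋
⌈n/2⌉≡1+⌊n/2⌋ (suc zero)    _  = refl
⌈n/2⌉≡1+⌊n/2⌋ (suc (suc n)) p₁ = cong suc (⌈n/2⌉≡1+⌊n/2⌋ n p₁)

parity-suc : ∀ n → parity (suc n) ≡ parity n ⁻¹
parity-suc n = sym (⁻¹-selfInverse (suc-homo-⁻¹ n))

parity≡0ℙ⇒even : ∀ {m} → parity m ≡ 0ℙ → Even m
parity≡0ℙ⇒even {zero}        _  = 2 ∣0
parity≡0ℙ⇒even {suc (suc m)} p₀ = ∣m∣n⇒∣m+n (∣-refl {2}) (parity≡0ℙ⇒even {m} p₀)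

even⇒parity≡0ℙ : ∀ {m} → Even m → parity m ≡ 0ℙ
even⇒parity≡0ℙ {zero}        _   = refl
even⇒parity≡0ℙ {suc zero}    2∣1 = contradiction 2∣1 (>⇒∤ (s≤s (s≤s z≤n)))
even⇒parity≡0ℙ {suc (suc m)} 2∣m = even⇒parity≡0ℙ {m} (∣m+n∣m⇒∣n 2∣m ∣-refl)

parity≡1ℙ⇒odd : ∀ {m} → parity m ≡ 1ℙ → Odd m
parity≡1ℙ⇒odd p₁ even = case trans (sym p₁) (even⇒parity≡0ℙ even) of λ ()

odd⇒parity≡1ℙ : ∀ {m} → Odd m → parity m ≡ 1ℙ
odd⇒parity≡1ℙ {m} odd with parity m in p
... | 1ℙ = refl
... | 0ℙ = contradiction (parity≡0ℙ⇒even p) odd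

occupied : Parity → ℕ → Bool
occupied ρ q = does (parity q ≟ℙ ρ)

occupied⇔ : ∀ ρ q → occupied ρ q ≡ true ⇔ parity q ≡ ρ
occupied⇔ ρ q with parity q ≟ℙ ρ
... | yes q∼ρ = mk⇔ (λ _ → q∼ρ) (λ _ → refl)
... | no q≁ρ  = mk⇔ (λ ()) (λ q∼ρ → contradiction q∼ρ q≁ρ)

occupied-0ℙ⇔even : ∀ q → occupied 0ℙ q ≡ true ⇔ Even q
occupied-0ℙ⇔even q = ⇔.trans (occupied⇔ 0ℙ q) (mk⇔ parity≡0ℙ⇒even even⇒parity≡0ℙ)

occupied-1ℙ⇔odd : ∀ q → occupied 1ℙ q ≡ true ⇔ Odd q
occupied-1ℙ⇔odd q = ⇔.trans (occupied⇔ 1ℙ q) (mk⇔ parity≡1ℙ⇒odd odd⇒parity≡1ℙ)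

occupied-parity : ∀ ρ q q′ → parity q ≡ parity q′ → occupied ρ q ≡ occupied ρ q′
occupied-parity ρ q q′ q≡q′ = cong (λ π → does (π ≟ℙ ρ)) q≡q′

occupied-suc : ∀ ρ q → occupied ρ (suc q) ≡ occupied (ρ ⁻¹) q
occupied-suc ρ q rewrite parity-suc q with parity q | ρ
... | 0ℙ | 0ℙ = refl
... | 0ℙ | 1ℙ = refl
... | 1ℙ | 0ℙ = refl
... | 1ℙ | 1ℙ = refl

occupied-suc⁻¹ : ∀ ρ q → occupied (ρ ⁻¹) (suc q) ≡ occupied ρ q
occupied-suc⁻¹ ρ q = trans (occupied-suc (ρ ⁻¹) q) (cong (λ π → occupied π q) (⁻¹-involutive ρ))

occupied-either : ∀ ρ q → occupied ρ q ≡ true ⊎ occupied ρ (suc q) ≡ true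
occupied-either ρ q rewrite occupied-suc ρ q with parity q | ρ
... | 0ℙ | 0ℙ = inj₁ refl
... | 0ℙ | 1ℙ = inj₂ refl
... | 1ℙ | 0ℙ = inj₂ refl
... | 1ℙ | 1ℙ = inj₁ refl

occupied-pred : ∀ ρ q → occupied ρ (suc q) ≡ false → occupied ρ q ≡ true
occupied-pred ρ q ∉ = [ id , (λ ∈ → case trans (sym ∈) ∉ of λ ()) ]′ (occupied-either ρ q)

occupied-next : ∀ ρ q → occupied ρ q ≡ false → occupied ρ (suc q) ≡ true
occupied-next ρ q ∉ = [ (λ ∈ → case trans (sym ∈) ∉ of λ ()) , id ]′ (occupied-either ρ q)

occupied-count-0ℙ : ∀ n → ∑[ j < n ] 𝟙 (occupied 0ℙ (suc (toℕ j))) ≡ ⌊ n /2⌋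
occupied-count-1ℙ : ∀ n → ∑[ j < n ] 𝟙 (occupied 1ℙ (suc (toℕ j))) ≡ ⌈ n /2⌉
occupied-count-0ℙ zero    = refl
occupied-count-0ℙ (suc n) =
  trans (sum-cong-≗ {n} λ j → cong 𝟙 (occupied-suc 0ℙ (suc (toℕ j)))) (occupied-count-1ℙ n)
occupied-count-1ℙ zero    = refl
occupied-count-1ℙ (suc n) =
  cong suc (trans (sum-cong-≗ {n} λ j → cong 𝟙 (occupied-suc 1ℙ (suc (toℕ j)))) (occupied-count-0ℙ n))

⇔-bool : ∀ {P : Set} {b c : Bool} → (b ≡ true ⇔ P) → (c ≡ true ⇔ P) → b ≡ c
⇔-bool {b = true}  {true}  _  _  = refl
⇔-bool {b = false} {false} _  _  = refl
⇔-bool {b = true}  {false} b⇔ c⇔ = sym (Equivalence.from c⇔ (Equivalence.to b⇔ refl))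
⇔-bool {b = false} {true}  b⇔ c⇔ = Equivalence.from b⇔ (Equivalence.to c⇔ refl)

module _ {m : ℕ} (u d : Fin m) where

  transpose-matchˡ : Perm.transpose u d ⟨$⟩ʳ u ≡ d
  transpose-matchˡ rewrite dec-true (u ≟ u) refl = refl

  transpose-matchʳ : Perm.transpose u d ⟨$⟩ʳ d ≡ u
  transpose-matchʳ with d ≟ u
  ... | yes refl = refl
  ... | no _ rewrite dec-true (d ≟ d) refl = refl

  transpose-fixed : ∀ {i} → i ≢ u → i ≢ d → Perm.transpose u d ⟨$⟩ʳ i ≡ i
  transpose-fixed {i} i≢u i≢d rewrite dec-false (i ≟ u) i≢u | dec-false (i ≟ d) i≢d = refl

-- Defenses in an arbitrary graph

module _ (G : FinGraph) where
  open FinGraph G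

  IsVertexCover-cong : ∀ {U U′ : VSet G} → U ≗ U′ → IsVertexCover G U → IsVertexCover G U′
  IsVertexCover-cong U≗U′ cover v w vw =
    Sum.map (trans (sym (U≗U′ v))) (trans (sym (U≗U′ w))) (cover v w vw)

  DefenseInto : (VSet G → Set) → VSet G → V → V → Set
  DefenseInto 𝒰 U v w =
    Σ (V → V) λ φ → IsDefense G U v w φ × Σ (VSet G) λ W → 𝒰 W × IsImage G U φ W

  record DefenseMove (U W : VSet G) (v w : V) : Set where
    field
      φ ψ     : V → V
      φ-nbhd  : ∀ x → U x ≡ true → InClosedNbhd G x (φ x)
      ψ∘φ     : ∀ x → U x ≡ true → ψ (φ x) ≡ x
      φ-into  : ∀ x → U x ≡ true → W (φ x) ≡ true
      ψ-into  : ∀ y → W y ≡ true → U (ψ y) ≡ true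
      φ∘ψ     : ∀ y → W y ≡ true → φ (ψ y) ≡ y
      answers : (U v ≡ true × φ v ≡ w) ⊎ (U w ≡ true × φ w ≡ v)

    isDefense : IsDefense G U v w φ
    isDefense = φ-nbhd , injective , answers
      where
      injective : ∀ x x′ → U x ≡ true → U x′ ≡ true → φ x ≡ φ x′ → x ≡ x′
      injective x x′ Ux Ux′ φx≡φx′ =
        trans (sym (ψ∘φ x Ux)) (trans (cong ψ φx≡φx′) (ψ∘φ x′ Ux′))

    isImage : IsImage G U φ W
    isImage y = mk⇔ (λ Wy → ψ y , ψ-into y Wy , φ∘ψ y Wy)
                    (λ { (x , Ux , refl) → φ-into x Ux })

    defenseInto : ∀ {𝒰} → 𝒰 W → DefenseInto 𝒰 U v w
    defenseInto W∈𝒰 = φ , isDefense , W , W∈𝒰 , isImage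

  module _ {U W : VSet G} {v w : V} where

    DefenseMove-sym : DefenseMove U W v w → DefenseMove U W w v
    DefenseMove-sym m = record { DefenseMove m; answers = swap (DefenseMove.answers m) }

    DefenseMove-cong : ∀ {U′ : VSet G} → U ≗ U′ → DefenseMove U W v w → DefenseMove U′ W v w
    DefenseMove-cong {U′} U≗U′ m = record
      { φ = φ ; ψ = ψ
      ; φ-nbhd  = λ x U′x → φ-nbhd x (from x U′x)
      ; ψ∘φ     = λ x U′x → ψ∘φ x (from x U′x)
      ; φ-into  = λ x U′x → φ-into x (from x U′x)
      ; ψ-into  = λ y Wy → to (ψ y) (ψ-into y Wy)
      ; φ∘ψ     = φ∘ψ
      ; answers = Sum.map (Product.map₁ (to _)) (Product.map₁ (to _)) answers
      }
      where
      open DefenseMove m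
      from : ∀ x → U′ x ≡ true → U x ≡ true
      from x U′x = trans (U≗U′ x) U′x
      to : ∀ x → U x ≡ true → U′ x ≡ true
      to x Ux = trans (sym (U≗U′ x)) Ux

  module _ (_≟ᵥ_ : DecidableEquality V) (a b : V) where

    transpose : V → V
    transpose x with x ≟ᵥ a | x ≟ᵥ b
    ... | yes _ | _     = b
    ... | no _  | yes _ = a
    ... | no _  | no _  = x

    transpose-a : transpose a ≡ b
    transpose-a with a ≟ᵥ a | a ≟ᵥ b
    ... | yes _   | _ = refl
    ... | no a≢a  | _ = contradiction refl a≢a

    transpose-b : transpose b ≡ a
    transpose-b with b ≟ᵥ a | b ≟ᵥ b
    ... | yes b≡a | _      = b≡a
    ... | no _    | yes _  = refl
    ... | no _    | no b≢b = contradiction refl b≢b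

    transpose-fixedᵥ : ∀ {x} → x ≢ a → x ≢ b → transpose x ≡ x
    transpose-fixedᵥ {x} x≢a x≢b with x ≟ᵥ a | x ≟ᵥ b
    ... | yes x≡a | _       = contradiction x≡a x≢a
    ... | no _    | yes x≡b = contradiction x≡b x≢b
    ... | no _    | no _    = refl

    transpose-involutive : ∀ x → transpose (transpose x) ≡ x
    transpose-involutive x with x ≟ᵥ a | x ≟ᵥ b
    ... | yes refl | _        = transpose-b
    ... | no _     | yes refl = transpose-a
    ... | no x≢a   | no x≢b   = transpose-fixedᵥ x≢a x≢b

    transposeMove : ∀ {U} → Adj a b → Adj b a → U a ≡ true → U b ≡ true → DefenseMove U U a b
    transposeMove {U} ab ba Ua Ub = record
      { φ = transpose ; ψ = transpose
      ; φ-nbhd = nbhd ; ψ∘φ = λ x _ → transpose-involutive x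
      ; φ-into = preserves ; ψ-into = preserves ; φ∘ψ = λ y _ → transpose-involutive y
      ; answers = inj₁ (Ua , transpose-a)
      }
      where
      nbhd : ∀ x → U x ≡ true → InClosedNbhd G x (transpose x)
      nbhd x _ with x ≟ᵥ a | x ≟ᵥ b
      ... | yes refl | _        = inj₂ ab
      ... | no _     | yes refl = inj₂ ba
      ... | no _     | no _     = inj₁ refl
      preserves : ∀ x → U x ≡ true → U (transpose x) ≡ true
      preserves x Ux with x ≟ᵥ a | x ≟ᵥ b
      ... | yes _ | _     = Ub
      ... | no _  | yes _ = Ua
      ... | no _  | no _  = Ux

  evc-lower-bound : ∀ {𝒰 m N v w} → Adj v w →
    (∀ U → IsVertexCover G U → U w ≡ true → N ≤ ∣_∣ₛ {G} U) → IsEVCClass G 𝒰 m → N ≤ m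
  evc-lower-bound {N = N} {v} {w} vw bound (lift (U , U∈𝒰) , lift sizes , lift defend)
    with U w in Uw
  ... | true = subst (N ≤_) (proj₂ (sizes U U∈𝒰)) (bound U (proj₁ (sizes U U∈𝒰)) Uw)
  ... | false with defend U U∈𝒰 v w vw
  ...   | _ , (_ , _ , inj₂ (Uw′ , _)) , _ = case trans (sym Uw) Uw′ of λ ()
  ...   | _ , (_ , _ , inj₁ (Uv , φv≡w)) , W , W∈𝒰 , image =
    subst (N ≤_) (proj₂ (sizes W W∈𝒰))
      (bound W (proj₁ (sizes W W∈𝒰)) (Equivalence.from (image w) (v , Uv , φv≡w)))

module MelonGraph (k : ℕ) (ℓ : Fin k → ℕ) (ℓ≥1 : ∀ i → 1 ≤ ℓ i) where

  At : Fin k → ℕ → MV k ℓ → Set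
  At = Defs.At

  n : Fin k → ℕ
  n i = ℓ i ∸ 1

  suc-n : ∀ i → suc (n i) ≡ ℓ i
  suc-n i with ℓ i | ℓ≥1 i
  ... | suc _ | _ = refl

  inner<ℓ : ∀ i (j : Fin (n i)) → suc (toℕ j) < ℓ i
  inner<ℓ i j = subst (suc (toℕ j) <_) (suc-n i) (s≤s (toℕ<n j))

  _≟ᵥ_ : DecidableEquality (MV k ℓ)
  s ≟ᵥ s         = yes refl
  s ≟ᵥ t         = no λ ()
  s ≟ᵥ inner _ _ = no λ ()
  t ≟ᵥ s         = no λ ()
  t ≟ᵥ t         = yes refl
  t ≟ᵥ inner _ _ = no λ ()
  inner _ _ ≟ᵥ s = no λ ()
  inner _ _ ≟ᵥ t = no λ ()
  inner i j ≟ᵥ inner i′ j′ with i ≟ i′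
  ... | no i≢i′ = no λ { refl → i≢i′ refl }
  ... | yes refl with j ≟ j′
  ...   | yes refl = yes refl
  ...   | no j≢j′  = no λ { refl → j≢j′ refl }

  vtx : Fin k → ℕ → MV k ℓ
  vtx i zero    = t
  vtx i (suc q) with q <? n i
  ... | yes q<n = inner i (fromℕ< q<n)
  ... | no _    = s

  vtx-At : ∀ i q → q ≤ ℓ i → At i q (vtx i q)
  vtx-At i zero    _   = at-t
  vtx-At i (suc q) q<ℓ with q <? n i
  ... | yes q<n = subst (λ p → At i p (inner i (fromℕ< q<n))) (cong suc (toℕ-fromℕ< q<n)) (at-in _)
  ... | no q≮n  = subst (λ p → At i p s) ℓ≡1+q at-s
    where
    ℓ≡1+q : ℓ i ≡ suc q
    ℓ≡1+q = trans (sym (suc-n i))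
              (cong suc (≤-antisym (≮⇒≥ q≮n) (≤-pred (subst (suc q ≤_) (sym (suc-n i)) q<ℓ))))

  At-vtx : ∀ {i q v} → At i q v → vtx i q ≡ v
  At-vtx     at-t      = refl
  At-vtx {i} at-s      = subst (λ q → vtx i q ≡ s) (suc-n i) vtx-end
    where
    vtx-end : vtx i (suc (n i)) ≡ s
    vtx-end with n i <? n i
    ... | yes n<n = contradiction n<n (<-irrefl refl)
    ... | no _    = refl
  At-vtx {i} (at-in j) with toℕ j <? n i
  ... | yes j<n = cong (inner i) (fromℕ<-toℕ j j<n)
  ... | no j≮n  = contradiction (toℕ<n j) j≮n

  At-≤ : ∀ {i q v} → At i q v → q ≤ ℓ i
  At-≤     at-t      = z≤n
  At-≤     at-s      = ≤-refl
  At-≤ {i} (at-in j) = <⇒≤ (inner<ℓ i j)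

  At-t : ∀ {i q} → At i q t → q ≡ 0
  At-t at-t = refl

  At-s : ∀ {i q} → At i q s → q ≡ ℓ i
  At-s at-s = refl

  At-adj : ∀ {i p v w} → At i p v → At i (suc p) w → MelonAdj k ℓ v w
  At-adj {i} {p} v-at w-at = i , p , inj₁ (v-at , w-at)

  At-adj⁻ : ∀ {i p v w} → At i p v → At i (suc p) w → MelonAdj k ℓ w v
  At-adj⁻ {i} {p} v-at w-at = i , p , inj₂ (v-at , w-at)

  parity-n : ∀ i → parity (n i) ≡ parity (ℓ i) ⁻¹
  parity-n i = sym (⁻¹-selfInverse (trans (sym (parity-suc (n i))) (cong parity (suc-n i))))

  ⌈n/2⌉-even-path : ∀ i → parity (ℓ i) ≡ 0ℙ → ⌈ n i /2⌉ ≡ suc ⌊ n i /2⌋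
  ⌈n/2⌉-even-path i ℓ-even = ⌈n/2⌉≡1+⌊n/2⌋ (n i) (trans (parity-n i) (cong _⁻¹ ℓ-even))

  ⌈n/2⌉-odd-path : ∀ i → parity (ℓ i) ≡ 1ℙ → ⌈ n i /2⌉ ≡ ⌊ n i /2⌋
  ⌈n/2⌉-odd-path i ℓ-odd = ⌈n/2⌉≡⌊n/2⌋ (n i) (trans (parity-n i) (cong _⁻¹ ℓ-odd))

  innerCount : (MV k ℓ → Bool) → Fin k → ℕ
  innerCount U i = ∑[ j < n i ] 𝟙 (U (inner i j))

  size-split : ∀ U → ∣_∣ₛ {Melon k ℓ} U ≡ 𝟙 (U s) + (𝟙 (U t) + ∑[ i < k ] innerCount U i)
  size-split U =
    trans (count-∷ U s (t ∷ paths)) (cong (𝟙 (U s) +_) (trans (count-∷ U t paths) (cong (𝟙 (U t) +_)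
      (trans (count-concatMap U (λ i → map (inner i) (allFin (n i))) id) (sum-cong-≗ {k} path-count)))))
    where
    paths : List (MV k ℓ)
    paths = concatMap (λ i → map (inner i) (allFin (n i))) (allFin k)
    path-count : ∀ i → count U (map (inner i) (allFin (n i))) ≡ innerCount U i
    path-count i = trans (cong (count U) (map-tabulate id (inner i))) (count-tabulate U (inner i))

  module _ {U : MV k ℓ → Bool} (cover : IsVertexCover (Melon k ℓ) U) where

    innerCount-bound : ∀ i (a : Bool) → a ≡ true ⊎ U (vtx i 1) ≡ true →
      ⌊ n i + (𝟙 (not a) + 𝟙 (not (U s))) /2⌋ ≤ innerCount U i
    innerCount-bound i a a∨first = ⌊/2⌋-≤ (innerCount U i)
      (subst₂ (λ z c → n i + (𝟙 (not a) + 𝟙 (not z)) ≤ suc (c + c))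
        (cong U (subst (λ q → vtx i q ≡ s) (sym (suc-n i)) (At-vtx at-s)))
        (sum-cong-≗ {n i} λ j → cong (𝟙 ∘ U) (At-vtx (at-in j)))
        (path-cover-bound (n i) b covered))
      where
      b : ℕ → Bool
      b zero    = a
      b (suc q) = U (vtx i (suc q))
      covered : ∀ p → p ≤ n i → b p ≡ true ⊎ b (suc p) ≡ true
      covered zero    _   = a∨first
      covered (suc p) p<n =
        cover _ _ (At-adj (vtx-At i (suc p) (≤-trans (n≤1+n _) p+2≤ℓ)) (vtx-At i (2 + p) p+2≤ℓ))
        where
        p+2≤ℓ : 2 + p ≤ ℓ i
        p+2≤ℓ = subst (2 + p ≤_) (suc-n i) (s≤s p<n)

    floor-bound : ∀ i → ⌊ n i + (𝟙 (not (U t)) + 𝟙 (not (U s))) /2⌋ ≤ innerCount U i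
    floor-bound i = innerCount-bound i (U t) (cover _ _ (At-adj at-t (vtx-At i 1 (ℓ≥1 i))))

    first-vertex-bound : ∀ i → U (vtx i 1) ≡ true → ⌈ n i /2⌉ ≤ innerCount U i
    first-vertex-bound i first =
      ≤-trans (⌊n/2⌋-mono (subst (_≤ n i + (1 + 𝟙 (not (U s)))) (+-comm (n i) 1)
                                  (+-monoʳ-≤ (n i) (m≤m+n 1 _))))
              (innerCount-bound i false (inj₂ first))

  coverNumber : ℕ
  coverNumber = 2 + ∑[ i < k ] ⌊ n i /2⌋

  -- The configurations U^{P_e}_{S_o}

  Phase : Set
  Phase = Fin k → Parity

  -- A phase gives each path the parity of its occupied inner positions, counted from t; s and t
  -- are always occupied.  U^{P_e}_{S_o} is C r for the phase that is 1ℙ exactly on P_e and S_o.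
  C : Phase → MV k ℓ → Bool
  C r s           = true
  C r t           = true
  C r (inner i j) = occupied (r i) (suc (toℕ j))

  C-cong : ∀ {r r′ : Phase} → r ≗ r′ → C r ≗ C r′
  C-cong r≗r′ s           = refl
  C-cong r≗r′ t           = refl
  C-cong r≗r′ (inner i j) = cong (λ ρ → occupied ρ (suc (toℕ j))) (r≗r′ i)

  C-At : ∀ r {i q v} → At i q v → occupied (r i) q ≡ true → C r v ≡ true
  C-At r at-t      _   = refl
  C-At r at-s      _   = refl
  C-At r (at-in j) occ = occ

  C-At-false : ∀ r {i q v} → At i q v → C r v ≡ false → occupied (r i) q ≡ false
  C-At-false r (at-in j) ∉C = ∉C

  C-cover : ∀ r → IsVertexCover (Melon k ℓ) (C r)
  C-cover r v w (i , p , inj₁ (v-at , w-at)) =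
    Sum.map (C-At r v-at) (C-At r w-at) (occupied-either (r i) p)
  C-cover r v w (i , p , inj₂ (w-at , v-at)) =
    swap (Sum.map (C-At r w-at) (C-At r v-at) (occupied-either (r i) p))

  size-C-internal : ∣_∣ₛ {Melon k ℓ} (C λ _ → 0ℙ) ≡ coverNumber
  size-C-internal =
    trans (size-split (C λ _ → 0ℙ)) (cong (2 +_) (sum-cong-≗ {k} λ i → occupied-count-0ℙ (n i)))

  record Admissible (r : Phase) : Set where
    field
      external        : Fin k
      external-even   : parity (ℓ external) ≡ 0ℙ
      external-phase  : r external ≡ 1ℙ
      external-unique : ∀ i → parity (ℓ i) ≡ 0ℙ → r i ≡ 1ℙ → i ≡ external
      s-path          : Fin k
      s-path-odd      : parity (ℓ s-path) ≡ 1ℙ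
      s-path-phase    : r s-path ≡ 1ℙ
      t-path          : Fin k
      t-path-odd      : parity (ℓ t-path) ≡ 1ℙ
      t-path-phase    : r t-path ≡ 0ℙ

    internal-phase : ∀ i → parity (ℓ i) ≡ 0ℙ → i ≢ external → r i ≡ 0ℙ
    internal-phase i ℓ-even i≢e with r i in rᵢ
    ... | 0ℙ = refl
    ... | 1ℙ = contradiction (external-unique i ℓ-even rᵢ) i≢e

  size-C-admissible : ∀ {r} → Admissible r → ∣_∣ₛ {Melon k ℓ} (C r) ≡ suc coverNumber
  size-C-admissible {r} adm = trans (size-split (C r)) (cong (2 +_) (∑-bump external balanced surplus))
    where
    open Admissible adm
    surplus : innerCount (C r) external ≡ suc ⌊ n external /2⌋
    surplus rewrite external-phase = trans (occupied-count-1ℙ _) (⌈n/2⌉-even-path external external-even)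
    balanced : ∀ i → i ≢ external → innerCount (C r) i ≡ ⌊ n i /2⌋
    balanced i i≢e with r i in rᵢ | parity (ℓ i) in ℓᵢ
    ... | 0ℙ | _  = occupied-count-0ℙ (n i)
    ... | 1ℙ | 0ℙ = contradiction (external-unique i ℓᵢ rᵢ) i≢e
    ... | 1ℙ | 1ℙ = trans (occupied-count-1ℙ (n i)) (⌈n/2⌉-odd-path i ℓᵢ)

  Admissible-permute : ∀ {r} (π : Permutation′ k) → (∀ i → parity (ℓ (π ⟨$⟩ʳ i)) ≡ parity (ℓ i)) →
                       Admissible r → Admissible (λ i → r (π ⟨$⟩ʳ i))
  Admissible-permute {r} π π-parity adm = record
    { external        = π ⟨$⟩ˡ external
    ; external-even   = trans (parity-ˡ external) external-even
    ; external-phase  = trans (cong r (inverseʳ π)) external-phase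
    ; external-unique = λ i ℓ-even rπᵢ≡1ℙ →
        trans (sym (inverseˡ π)) (cong (π ⟨$⟩ˡ_) (external-unique _ (trans (π-parity i) ℓ-even) rπᵢ≡1ℙ))
    ; s-path          = π ⟨$⟩ˡ s-path
    ; s-path-odd      = trans (parity-ˡ s-path) s-path-odd
    ; s-path-phase    = trans (cong r (inverseʳ π)) s-path-phase
    ; t-path          = π ⟨$⟩ˡ t-path
    ; t-path-odd      = trans (parity-ˡ t-path) t-path-odd
    ; t-path-phase    = trans (cong r (inverseʳ π)) t-path-phase
    }
    where
    open Admissible adm
    parity-ˡ : ∀ j → parity (ℓ (π ⟨$⟩ˡ j)) ≡ parity (ℓ j)
    parity-ˡ j = trans (sym (π-parity (π ⟨$⟩ˡ j))) (cong (parity ∘ ℓ) (inverseʳ π))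

  admissible-phase : ∀ e o₁ o₀ → parity (ℓ e) ≡ 0ℙ → parity (ℓ o₁) ≡ 1ℙ → parity (ℓ o₀) ≡ 1ℙ →
                     o₁ ≢ o₀ → Σ Phase Admissible
  admissible-phase e o₁ o₀ ℓₑ ℓ₁ ℓ₀ o₁≢o₀ = r , record
    { external = e  ; external-even = ℓₑ ; external-phase = r-e ; external-unique = unique
    ; s-path   = o₁ ; s-path-odd    = ℓ₁ ; s-path-phase   = r-o₁
    ; t-path   = o₀ ; t-path-odd    = ℓ₀ ; t-path-phase   = r-o₀
    }
    where
    r : Phase
    r i with i ≟ e | i ≟ o₁
    ... | yes _ | _     = 1ℙ
    ... | no _  | yes _ = 1ℙ
    ... | no _  | no _  = 0ℙ
    r-e : r e ≡ 1ℙ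
    r-e with e ≟ e
    ... | yes _  = refl
    ... | no e≢e = contradiction refl e≢e
    r-o₁ : r o₁ ≡ 1ℙ
    r-o₁ with o₁ ≟ e | o₁ ≟ o₁
    ... | yes _ | _        = refl
    ... | no _  | yes _    = refl
    ... | no _  | no o₁≢o₁ = contradiction refl o₁≢o₁
    r-o₀ : r o₀ ≡ 0ℙ
    r-o₀ with o₀ ≟ e | o₀ ≟ o₁
    ... | yes refl | _         = case trans (sym ℓₑ) ℓ₀ of λ ()
    ... | no _     | yes o₀≡o₁ = contradiction (sym o₀≡o₁) o₁≢o₀
    ... | no _     | no _      = refl
    unique : ∀ i → parity (ℓ i) ≡ 0ℙ → r i ≡ 1ℙ → i ≡ e
    unique i ℓᵢ rᵢ with i ≟ e | i ≟ o₁
    ... | yes i≡e | _        = i≡e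
    ... | no _    | yes refl = case trans (sym ℓᵢ) ℓ₁ of λ ()
    ... | no _    | no _     = case rᵢ of λ ()

  C-isU : ∀ r e So → r e ≡ 1ℙ →
    (∀ i → Even (ℓ i) → i ≢ e → r i ≡ 0ℙ) →
    (∀ i → Odd (ℓ i) → So i ≡ true → r i ≡ 1ℙ) →
    (∀ i → Odd (ℓ i) → So i ≡ false → r i ≡ 0ℙ) →
    IsU k ℓ e So (C r)
  C-isU r e So rₑ internal s-paths t-paths = external , internal′ , s-paths′ , t-paths′
    where
    phase-0ℙ : ∀ {i} (j : Fin (n i)) → r i ≡ 0ℙ → C r (inner i j) ≡ true ⇔ Even (suc (toℕ j))
    phase-0ℙ j rᵢ = let q = suc (toℕ j) in
      subst (λ ρ → occupied ρ q ≡ true ⇔ Even q) (sym rᵢ) (occupied-0ℙ⇔even q)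
    phase-1ℙ : ∀ {i} (j : Fin (n i)) → r i ≡ 1ℙ → C r (inner i j) ≡ true ⇔ Odd (suc (toℕ j))
    phase-1ℙ j rᵢ = let q = suc (toℕ j) in
      subst (λ ρ → occupied ρ q ≡ true ⇔ Odd q) (sym rᵢ) (occupied-1ℙ⇔odd q)
    external : IsExternal (C r) e
    external _ _ at-t      = mk⇔ (λ _ → inj₂ (inj₂ refl)) (λ _ → refl)
    external _ _ at-s      = mk⇔ (λ _ → inj₂ (inj₁ refl)) (λ _ → refl)
    external _ _ (at-in j) = mk⇔ (inj₁ ∘ Equivalence.to (phase-1ℙ j rₑ))
      [ Equivalence.from (phase-1ℙ j rₑ) , [ (λ ()) , (λ ()) ]′ ]′
    internal′ : ∀ i → Even (ℓ i) → i ≢ e → IsInternal (C r) i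
    internal′ i ℓ-even i≢e _ _ at-t      = mk⇔ (λ _ → 2 ∣0) (λ _ → refl)
    internal′ i ℓ-even i≢e _ _ at-s      = mk⇔ (λ _ → ℓ-even) (λ _ → refl)
    internal′ i ℓ-even i≢e _ _ (at-in j) = phase-0ℙ j (internal i ℓ-even i≢e)
    s-paths′ : ∀ i → Odd (ℓ i) → So i ≡ true → IsSPath (C r) i
    s-paths′ i ℓ-odd Soᵢ _ _ at-t      t≢t = contradiction refl t≢t
    s-paths′ i ℓ-odd Soᵢ _ _ at-s      _   = mk⇔ (λ _ → ℓ-odd) (λ _ → refl)
    s-paths′ i ℓ-odd Soᵢ _ _ (at-in j) _   = phase-1ℙ j (s-paths i ℓ-odd Soᵢ)
    t-paths′ : ∀ i → Odd (ℓ i) → So i ≡ false → IsTPath (C r) i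
    t-paths′ i ℓ-odd Soᵢ _ _ at-t      _   = mk⇔ (λ _ → 2 ∣0) (λ _ → refl)
    t-paths′ i ℓ-odd Soᵢ _ _ at-s      s≢s = contradiction refl s≢s
    t-paths′ i ℓ-odd Soᵢ _ _ (at-in j) _   = phase-0ℙ j (t-paths i ℓ-odd Soᵢ)

  IsU-unique : ∀ {e So U U′} → IsU k ℓ e So U → IsU k ℓ e So U′ → U ≗ U′
  IsU-unique {e} {So} {U} {U′} (ext , int , sp , tp) (ext′ , int′ , sp′ , tp′) = agree
    where
    agree : ∀ v → U v ≡ U′ v
    agree s = ⇔-bool (ext _ _ at-s) (ext′ _ _ at-s)
    agree t = ⇔-bool (ext _ _ at-t) (ext′ _ _ at-t)
    agree (inner i j) with i ≟ e | parity (ℓ i) in ℓᵢ | So i in Soᵢ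
    ... | yes refl | _  | _     = ⇔-bool (ext _ _ (at-in j)) (ext′ _ _ (at-in j))
    ... | no i≢e   | 0ℙ | _     = let ℓ-even = parity≡0ℙ⇒even ℓᵢ in
      ⇔-bool (int i ℓ-even i≢e _ _ (at-in j)) (int′ i ℓ-even i≢e _ _ (at-in j))
    ... | no _     | 1ℙ | true  = let ℓ-odd = parity≡1ℙ⇒odd ℓᵢ in
      ⇔-bool (sp i ℓ-odd Soᵢ _ _ (at-in j) λ ()) (sp′ i ℓ-odd Soᵢ _ _ (at-in j) λ ())
    ... | no _     | 1ℙ | false = let ℓ-odd = parity≡1ℙ⇒odd ℓᵢ in
      ⇔-bool (tp i ℓ-odd Soᵢ _ _ (at-in j) λ ()) (tp′ i ℓ-odd Soᵢ _ _ (at-in j) λ ())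

  C∈𝒰 : ∀ {r} → Admissible r → 𝒰Family k ℓ (C r)
  C∈𝒰 {r} adm =
    external , parity≡0ℙ⇒even external-even , So
    , (s-path , parity≡1ℙ⇒odd s-path-odd , dec-true (r s-path ≟ℙ 1ℙ) s-path-phase)
    , (t-path , parity≡1ℙ⇒odd t-path-odd ,
       dec-false (r t-path ≟ℙ 1ℙ) λ r≡1ℙ → case trans (sym t-path-phase) r≡1ℙ of λ ())
    , C-isU r external So external-phase (λ i → internal-phase i ∘ even⇒parity≡0ℙ) s-paths t-paths
    where
    open Admissible adm
    So : Fin k → Bool
    So i = does (r i ≟ℙ 1ℙ)
    s-paths : ∀ i → Odd (ℓ i) → So i ≡ true → r i ≡ 1ℙ
    s-paths i _ Soᵢ with r i
    ... | 1ℙ = refl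
    t-paths : ∀ i → Odd (ℓ i) → So i ≡ false → r i ≡ 0ℙ
    t-paths i _ Soᵢ with r i
    ... | 0ℙ = refl

  𝒰⇒C : ∀ {U} → 𝒰Family k ℓ U → Σ Phase λ r → Admissible r × U ≗ C r
  𝒰⇒C {U} (e , e-even , So , (o₁ , o₁-odd , So₁) , (o₀ , o₀-odd , So₀) , isU) =
    r , adm , IsU-unique isU (C-isU r e So r-e internal s-paths t-paths)
    where
    r : Phase
    r i with i ≟ e | parity (ℓ i) | So i
    ... | yes _ | _  | _     = 1ℙ
    ... | no _  | 0ℙ | _     = 0ℙ
    ... | no _  | 1ℙ | true  = 1ℙ
    ... | no _  | 1ℙ | false = 0ℙ
    r-e : r e ≡ 1ℙ
    r-e with e ≟ e
    ... | yes _  = refl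
    ... | no e≢e = contradiction refl e≢e
    internal : ∀ i → Even (ℓ i) → i ≢ e → r i ≡ 0ℙ
    internal i ℓ-even i≢e with i ≟ e | parity (ℓ i) in ℓᵢ
    ... | yes i≡e | _  = contradiction i≡e i≢e
    ... | no _    | 0ℙ = refl
    ... | no _    | 1ℙ = contradiction ℓ-even (parity≡1ℙ⇒odd ℓᵢ)
    s-paths : ∀ i → Odd (ℓ i) → So i ≡ true → r i ≡ 1ℙ
    s-paths i ℓ-odd Soᵢ with i ≟ e | parity (ℓ i) in ℓᵢ
    ... | yes _ | _  = refl
    ... | no _  | 0ℙ = contradiction (parity≡0ℙ⇒even ℓᵢ) ℓ-odd
    ... | no _  | 1ℙ rewrite Soᵢ = refl
    t-paths : ∀ i → Odd (ℓ i) → So i ≡ false → r i ≡ 0ℙ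
    t-paths i ℓ-odd Soᵢ with i ≟ e | parity (ℓ i) in ℓᵢ
    ... | yes refl | _  = contradiction e-even ℓ-odd
    ... | no _     | 0ℙ = contradiction (parity≡0ℙ⇒even ℓᵢ) ℓ-odd
    ... | no _     | 1ℙ rewrite Soᵢ = refl
    adm : Admissible r
    adm = record
      { external        = e
      ; external-even   = even⇒parity≡0ℙ e-even
      ; external-phase  = r-e
      ; external-unique = λ i ℓ-even rᵢ≡1ℙ → decidable-stable (i ≟ e) λ i≢e →
          case trans (sym rᵢ≡1ℙ) (internal i (parity≡0ℙ⇒even ℓ-even) i≢e) of λ ()
      ; s-path = o₁ ; s-path-odd = odd⇒parity≡1ℙ o₁-odd ; s-path-phase = s-paths o₁ o₁-odd So₁
      ; t-path = o₀ ; t-path-odd = odd⇒parity≡1ℙ o₀-odd ; t-path-phase = t-paths o₀ o₀-odd So₀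
      }

  -- Rotating guards around an even cycle

  -- One step around the cycle t → up → s → down → t.  Below, t and s are told to move exactly
  -- when the vertex before them on the cycle is occupied.
  rotate : (up down : Fin k) (tMoves sMoves : Bool) → MV k ℓ → MV k ℓ
  rotate up down tMoves sMoves t = if tMoves then vtx up 1 else t
  rotate up down tMoves sMoves s = if sMoves then vtx down (n down) else s
  rotate up down tMoves sMoves (inner i j) with i ≟ up | i ≟ down
  ... | yes _ | _     = vtx i (2 + toℕ j)
  ... | no _  | yes _ = vtx i (toℕ j)
  ... | no _  | no _  = inner i j

  rotate-nbhd : ∀ up down tMoves sMoves x → InClosedNbhd (Melon k ℓ) x (rotate up down tMoves sMoves x)
  rotate-nbhd up down tMoves sMoves t with tMoves
  ... | true  = inj₂ (At-adj at-t (vtx-At up 1 (ℓ≥1 up)))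
  ... | false = inj₁ refl
  rotate-nbhd up down tMoves sMoves s with sMoves
  ... | true  = inj₂ (At-adj⁻ (vtx-At down (n down) (subst (n down ≤_) (suc-n down) (n≤1+n _)))
                              (subst (λ q → At down q s) (sym (suc-n down)) at-s))
  ... | false = inj₁ refl
  rotate-nbhd up down tMoves sMoves (inner i j) with i ≟ up | i ≟ down
  ... | yes refl | _        = inj₂ (At-adj (at-in j) (vtx-At i (2 + toℕ j) (inner<ℓ i j)))
  ... | no _     | yes refl =
    inj₂ (At-adj⁻ (vtx-At i (toℕ j) (≤-trans (n≤1+n _) (<⇒≤ (inner<ℓ i j)))) (at-in j))
  ... | no _     | no _     = inj₁ refl

  rotate-fixed : ∀ {up down tMoves sMoves i} (j : Fin (n i)) → i ≢ up → i ≢ down →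
                 rotate up down tMoves sMoves (inner i j) ≡ inner i j
  rotate-fixed {up} {down} {i = i} j i≢up i≢down with i ≟ up | i ≟ down
  ... | yes i≡up | _          = contradiction i≡up i≢up
  ... | no _     | yes i≡down = contradiction i≡down i≢down
  ... | no _     | no _       = refl

  module _ {up down : Fin k} {tMoves sMoves : Bool} (up≢down : up ≢ down) where

    rotate-up : ∀ {p x y} → At up p x → At up (suc p) y → (x ≡ t → tMoves ≡ true) →
                rotate up down tMoves sMoves x ≡ y
    rotate-up at-t      y-at moves rewrite moves refl = At-vtx y-at
    rotate-up at-s      y-at _ = contradiction (At-≤ y-at) (<-irrefl refl)
    rotate-up (at-in j) y-at _ with up ≟ up | up ≟ down
    ... | yes _    | _ = At-vtx y-at
    ... | no up≢up | _ = contradiction refl up≢up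

    rotate-down : ∀ {q p x y} → At down q x → At down p y → q ≡ suc p → (x ≡ s → sMoves ≡ true) →
                  rotate up down tMoves sMoves x ≡ y
    rotate-down at-s      y-at ℓ≡1+p moves rewrite moves refl =
      trans (cong (vtx down) (suc-injective (trans (suc-n down) ℓ≡1+p))) (At-vtx y-at)
    rotate-down (at-in j) y-at j+1≡1+p _ with down ≟ up | down ≟ down
    ... | yes down≡up | _            = contradiction (sym down≡up) up≢down
    ... | no _        | yes _        = trans (cong (vtx down) (suc-injective j+1≡1+p)) (At-vtx y-at)
    ... | no _        | no down≢down = contradiction refl down≢down

  -- The moves of t and s are parameters, fixed by their equations, so that the inverse rotation
  -- (an instance of this module for the swapped phases) makes literally the same moves.
  module Rotation (r : Phase) (u d : Fin k) (u≢d : u ≢ d)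
                  (same-parity : parity (ℓ u) ≡ parity (ℓ d)) (opposite : r d ≡ r u ⁻¹)
                  (tMoves sMoves : Bool)
                  (tMoves≡ : tMoves ≡ occupied (r d) 1) (sMoves≡ : sMoves ≡ occupied (r u) (n u)) where

    φ ψ : MV k ℓ → MV k ℓ
    φ = rotate u d tMoves sMoves
    ψ = rotate d u tMoves sMoves

    r′ : Phase
    r′ i = r (Perm.transpose u d ⟨$⟩ʳ i)

    r′-u≡r-d : r′ u ≡ r d
    r′-u≡r-d = cong r (transpose-matchˡ u d)

    r′-d≡r-u : r′ d ≡ r u
    r′-d≡r-u = cong r (transpose-matchʳ u d)

    r-u≡r-d⁻¹ : r u ≡ r d ⁻¹
    r-u≡r-d⁻¹ = sym (⁻¹-selfInverse (sym opposite))

    parity-n-u≡d : parity (n u) ≡ parity (n d)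
    parity-n-u≡d = trans (parity-n u) (trans (cong _⁻¹ same-parity) (sym (parity-n d)))

    tMoves-u : tMoves ≡ occupied (r u) 0
    tMoves-u = trans tMoves≡ (trans (cong (λ ρ → occupied ρ 1) opposite) (occupied-suc⁻¹ (r u) 0))

    sMoves-d : sMoves ≡ occupied (r d) (ℓ d)
    sMoves-d = begin
      sMoves                      ≡⟨ sMoves≡ ⟩
      occupied (r u) (n u)        ≡⟨ occupied-parity (r u) (n u) (n d) parity-n-u≡d ⟩
      occupied (r u) (n d)        ≡⟨ cong (λ ρ → occupied ρ (n d)) r-u≡r-d⁻¹ ⟩
      occupied (r d ⁻¹) (n d)     ≡⟨ occupied-suc (r d) (n d) ⟨
      occupied (r d) (suc (n d))  ≡⟨ cong (occupied (r d)) (suc-n d) ⟩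
      occupied (r d) (ℓ d)        ∎
      where open ≡-Reasoning

    Image : MV k ℓ → Set
    Image x = Σ (MV k ℓ) λ y → φ x ≡ y × ψ y ≡ x × C r′ y ≡ true

    moving-up : ∀ {p x} → At u p x → p < ℓ u → occupied (r u) p ≡ true → Image x
    moving-up {p} {x} x-at p<ℓ occ = vtx u (suc p) , φx≡y , ψy≡x , y∈C′
      where
      y-at : At u (suc p) (vtx u (suc p))
      y-at = vtx-At u (suc p) p<ℓ
      φx≡y : φ x ≡ vtx u (suc p)
      φx≡y = rotate-up u≢d x-at y-at λ { refl →
        trans tMoves-u (subst (λ q → occupied (r u) q ≡ true) (At-t x-at) occ) }
      ψy≡x : ψ (vtx u (suc p)) ≡ x
      ψy≡x = rotate-down (u≢d ∘ sym) y-at x-at refl λ y≡s →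
        trans sMoves≡ (subst (λ q → occupied (r u) q ≡ true)
          (suc-injective (trans (At-s (subst (At u (suc p)) y≡s y-at)) (sym (suc-n u)))) occ)
      y∈C′ : C r′ (vtx u (suc p)) ≡ true
      y∈C′ = C-At r′ y-at (begin
        occupied (r′ u) (suc p)      ≡⟨ cong (λ ρ → occupied ρ (suc p)) (trans r′-u≡r-d opposite) ⟩
        occupied (r u ⁻¹) (suc p)    ≡⟨ occupied-suc⁻¹ (r u) p ⟩
        occupied (r u) p             ≡⟨ occ ⟩
        true                         ∎)
        where open ≡-Reasoning

    moving-down : ∀ {q p x} → At d q x → q ≡ suc p → occupied (r d) q ≡ true → Image x
    moving-down {q} {p} {x} x-at q≡1+p occ = vtx d p , φx≡y , ψy≡x , y∈C′
      where
      x-at′ : At d (suc p) x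
      x-at′ = subst (λ q → At d q x) q≡1+p x-at
      y-at : At d p (vtx d p)
      y-at = vtx-At d p (≤-trans (n≤1+n p) (At-≤ x-at′))
      φx≡y : φ x ≡ vtx d p
      φx≡y = rotate-down u≢d x-at y-at q≡1+p λ { refl →
        trans sMoves-d (subst (λ q → occupied (r d) q ≡ true) (At-s x-at) occ) }
      ψy≡x : ψ (vtx d p) ≡ x
      ψy≡x = rotate-up (u≢d ∘ sym) y-at x-at′ λ y≡t →
        trans tMoves≡ (subst (λ q → occupied (r d) q ≡ true)
                             (trans q≡1+p (cong suc (At-t (subst (At d p) y≡t y-at)))) occ)
      y∈C′ : C r′ (vtx d p) ≡ true
      y∈C′ = C-At r′ y-at (begin
        occupied (r′ d) p            ≡⟨ cong (λ ρ → occupied ρ p) (trans r′-d≡r-u r-u≡r-d⁻¹) ⟩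
        occupied (r d ⁻¹) p          ≡⟨ occupied-suc (r d) p ⟨
        occupied (r d) (suc p)       ≡⟨ cong (occupied (r d)) q≡1+p ⟨
        occupied (r d) q             ≡⟨ occ ⟩
        true                         ∎)
        where open ≡-Reasoning

    image : ∀ x → C r x ≡ true → Image x
    image t _ with occupied (r u) 0 in occ
    ... | true  = moving-up at-t (ℓ≥1 u) occ
    ... | false = t , cong (λ b → if b then vtx u 1 else t) (trans tMoves-u occ)
                    , cong (λ b → if b then vtx d 1 else t) (trans tMoves-u occ) , refl
    image s _ with occupied (r d) (ℓ d) in occ
    ... | true  = moving-down at-s (sym (suc-n d)) occ
    ... | false = s , cong (λ b → if b then vtx d (n d) else s) (trans sMoves-d occ)
                    , cong (λ b → if b then vtx u (n u) else s) (trans sMoves-d occ) , refl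
    image (inner i j) x∈C = image-inner (i ≟ u) (i ≟ d)
      where
      image-inner : Dec (i ≡ u) → Dec (i ≡ d) → Image (inner i j)
      image-inner (yes refl) _          = moving-up (at-in j) (inner<ℓ i j) x∈C
      image-inner (no _)     (yes refl) = moving-down {p = toℕ j} (at-in j) refl x∈C
      image-inner (no i≢u)   (no i≢d)   = inner i j
        , rotate-fixed {tMoves = tMoves} {sMoves} j i≢u i≢d
        , rotate-fixed {tMoves = tMoves} {sMoves} j i≢d i≢u
        , trans (cong (λ ρ → occupied ρ (suc (toℕ j))) (cong r (transpose-fixed u d i≢u i≢d))) x∈C

    answers-up : ∀ {p a b} → At u p a → At u (suc p) b → C r b ≡ false → φ a ≡ b
    answers-up a-at b-at b∉C = rotate-up u≢d a-at b-at λ { refl →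
      trans tMoves-u (occupied-pred (r u) 0
        (subst (λ p → occupied (r u) (suc p) ≡ false) (At-t a-at) (C-At-false r b-at b∉C))) }

    answers-down : ∀ {p a b} → At d p a → At d (suc p) b → C r a ≡ false → φ b ≡ a
    answers-down {p} a-at b-at a∉C = rotate-down u≢d b-at a-at refl λ { refl →
      trans sMoves-d (subst (λ q → occupied (r d) q ≡ true) (At-s b-at)
                            (occupied-next (r d) p (C-At-false r a-at a∉C))) }

  module RotationMove (r : Phase) (u d : Fin k) (u≢d : u ≢ d)
                      (same-parity : parity (ℓ u) ≡ parity (ℓ d)) (opposite : r d ≡ r u ⁻¹) where

    open Rotation r u d u≢d same-parity opposite (occupied (r d) 1) (occupied (r u) (n u)) refl refl
      public

    module Back = Rotation r′ d u (u≢d ∘ sym) (sym same-parity)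
      (trans r′-u≡r-d (trans opposite (cong _⁻¹ (sym r′-d≡r-u))))
      (occupied (r d) 1) (occupied (r u) (n u))
      (cong (λ ρ → occupied ρ 1) (sym r′-u≡r-d))
      (trans (occupied-parity (r u) (n u) (n d) parity-n-u≡d)
             (cong (λ ρ → occupied ρ (n d)) (sym r′-d≡r-u)))

    move : ∀ {a b} → (C r a ≡ true × φ a ≡ b) ⊎ (C r b ≡ true × φ b ≡ a) →
           DefenseMove (Melon k ℓ) (C r) (C r′) a b
    move answers = record
      { φ = φ ; ψ = ψ
      ; φ-nbhd = λ x _ → rotate-nbhd u d _ _ x
      ; ψ∘φ    = λ x x∈C → let _ , φx≡y , ψy≡x , _ = image x x∈C in trans (cong ψ φx≡y) ψy≡x
      ; φ-into = λ x x∈C → let _ , φx≡y , _ , y∈C′ = image x x∈C in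
                           subst (λ z → C r′ z ≡ true) (sym φx≡y) y∈C′
      ; ψ-into = λ y y∈C′ → let x , ψy≡x , _ , x∈C = Back.image y y∈C′ in
                           subst (λ z → C r z ≡ true) (sym ψy≡x)
                                 (trans (C-cong {r} {Back.r′} (λ _ → sym (cong r (PC.transpose-inverse u d))) x)
                                        x∈C)
      ; φ∘ψ    = λ y y∈C′ → let _ , ψy≡x , φx≡y , _ = Back.image y y∈C′ in trans (cong φ ψy≡x) φx≡y
      ; answers = answers
      }

    admissible : Admissible r → Admissible r′
    admissible = Admissible-permute (Perm.transpose u d) preserves-parity
      where
      preserves-parity : ∀ i → parity (ℓ (Perm.transpose u d ⟨$⟩ʳ i)) ≡ parity (ℓ i)
      preserves-parity i = by-cases (i ≟ u) (i ≟ d)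
        where
        by-cases : Dec (i ≡ u) → Dec (i ≡ d) → parity (ℓ (Perm.transpose u d ⟨$⟩ʳ i)) ≡ parity (ℓ i)
        by-cases (yes refl) _          = trans (cong (parity ∘ ℓ) (transpose-matchˡ u d)) (sym same-parity)
        by-cases (no _)     (yes refl) = trans (cong (parity ∘ ℓ) (transpose-matchʳ u d)) same-parity
        by-cases (no i≢u)   (no i≢d)   = cong (parity ∘ ℓ) (transpose-fixed u d i≢u i≢d)

  -- Melons with two even paths

  module TwoEvenPaths (e₁ e₂ : Fin k) (e₁≢e₂ : e₁ ≢ e₂)
                      (e₁-even : parity (ℓ e₁) ≡ 0ℙ) (e₂-even : parity (ℓ e₂) ≡ 0ℙ) where

    cover-size-bound : 4 ≤ k → ∀ {U} → IsVertexCover (Melon k ℓ) U →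
                       coverNumber + 𝟙 (U (vtx e₁ 1)) ≤ ∣_∣ₛ {Melon k ℓ} U
    cover-size-bound k≥4 {U} cover = subst (coverNumber + 𝟙 (U (vtx e₁ 1)) ≤_) (sym (size-split U))
      (by-ends (U s) (U t) (U (vtx e₁ 1)) (floor-bound cover) (first-vertex-bound cover e₁))
      where
      F I : Fin k → ℕ
      F i = ⌊ n i /2⌋
      I = innerCount U
      ∑F : ℕ
      ∑F = ∑[ i < k ] F i
      F<⌊n+1/2⌋ : ∀ {i} → parity (ℓ i) ≡ 0ℙ → F i < ⌊ n i + 1 /2⌋
      F<⌊n+1/2⌋ {i} ℓ-even =
        ≤-reflexive (trans (sym (⌈n/2⌉-even-path i ℓ-even)) (cong ⌊_/2⌋ (+-comm 1 (n i))))
      one-end-missing : ∀ x → (∀ i → ⌊ n i + 1 /2⌋ ≤ I i) → 1 + ∑F + 𝟙 x ≤ sum I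
      one-end-missing x floor = ≤-trans (+𝟙≤suc (1 + ∑F) x)
        (∑-mono-<₂ e₁ e₂ e₁≢e₂ (λ i → ≤-trans (⌊n/2⌋-mono (m≤m+n (n i) 1)) (floor i))
          (≤-trans (F<⌊n+1/2⌋ e₁-even) (floor e₁)) (≤-trans (F<⌊n+1/2⌋ e₂-even) (floor e₂)))
      both-ends : ∀ x → (∀ i → F i ≤ I i) → (x ≡ true → ⌈ n e₁ /2⌉ ≤ I e₁) → ∑F + 𝟙 x ≤ sum I
      both-ends true  F≤I first = subst (_≤ sum I) (+-comm 1 ∑F)
        (∑-mono-< e₁ F≤I (subst (_≤ I e₁) (⌈n/2⌉-even-path e₁ e₁-even) (first refl)))
      both-ends false F≤I _     = subst (_≤ sum I) (sym (+-identityʳ ∑F)) (∑-mono-≤ F≤I)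
      by-ends : ∀ bs bt x →
        (∀ i → ⌊ n i + (𝟙 (not bt) + 𝟙 (not bs)) /2⌋ ≤ I i) → (x ≡ true → ⌈ n e₁ /2⌉ ≤ I e₁) →
        coverNumber + 𝟙 x ≤ 𝟙 bs + (𝟙 bt + sum I)
      by-ends true  true  x floor first =
        s≤s (s≤s (both-ends x (λ i → subst (λ m → ⌊ m /2⌋ ≤ I i) (+-identityʳ (n i)) (floor i)) first))
      by-ends true  false x floor _ = s≤s (one-end-missing x floor)
      by-ends false true  x floor _ = s≤s (one-end-missing x floor)
      by-ends false false x floor _ = begin
        2 + ∑F + 𝟙 x          ≤⟨ +𝟙≤suc (2 + ∑F) x ⟩
        3 + ∑F                ≤⟨ +-monoˡ-≤ ∑F (≤-trans (n≤1+n 3) k≥4) ⟩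
        k + ∑F                ≡⟨ ∑-suc F ⟨
        ∑[ i < k ] suc (F i)  ≤⟨ ∑-mono-≤ (λ i → subst (_≤ I i) (cong ⌊_/2⌋ (+-comm (n i) 2))
                                                          (floor i)) ⟩
        sum I                 ∎
        where open ≤-Reasoning

    isVCNumber : 4 ≤ k → IsVCNumber (Melon k ℓ) coverNumber
    isVCNumber k≥4 = (C (λ _ → 0ℙ) , C-cover _ , size-C-internal) ,
                     λ U cover → ≤-trans (m≤m+n coverNumber _) (cover-size-bound k≥4 cover)

    evc-bound : 4 ≤ k → ∀ {𝒰 m} → IsEVCClass (Melon k ℓ) 𝒰 m → suc coverNumber ≤ m
    evc-bound k≥4 = evc-lower-bound (Melon k ℓ) (At-adj at-t (vtx-At e₁ 1 (ℓ≥1 e₁)))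
      λ U cover first∈U →
        subst (_≤ ∣_∣ₛ {Melon k ℓ} U)
              (trans (cong (λ b → coverNumber + 𝟙 b) first∈U) (+-comm coverNumber 1))
              (cover-size-bound k≥4 cover)

    partner : ∀ {r} → Admissible r → ∀ i →
              Σ (Fin k) λ j → j ≢ i × parity (ℓ i) ≡ parity (ℓ j) × r j ≡ r i ⁻¹
    partner {r} adm i = let j , ℓ≡ , r≡ = same-parity-opposite-phase in
      j , (λ j≡i → p≢p⁻¹ (r i) (trans (cong r (sym j≡i)) r≡)) , ℓ≡ , r≡
      where
      open Admissible adm
      other-even : Σ (Fin k) λ j → parity (ℓ j) ≡ 0ℙ × j ≢ external
      other-even with e₁ ≟ external
      ... | yes refl = e₂ , e₂-even , e₁≢e₂ ∘ sym
      ... | no e₁≢e  = e₁ , e₁-even , e₁≢e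
      same-parity-opposite-phase : Σ (Fin k) λ j → parity (ℓ i) ≡ parity (ℓ j) × r j ≡ r i ⁻¹
      same-parity-opposite-phase with parity (ℓ i) in ℓᵢ | r i in rᵢ
      ... | 0ℙ | 0ℙ = external , sym external-even , external-phase
      ... | 0ℙ | 1ℙ = let j , ℓⱼ , j≢e = other-even in j , sym ℓⱼ , internal-phase j ℓⱼ j≢e
      ... | 1ℙ | 0ℙ = s-path , sym s-path-odd , s-path-phase
      ... | 1ℙ | 1ℙ = t-path , sym t-path-odd , t-path-phase

    edge-defense : ∀ {r} → Admissible r → ∀ {i p a b} → At i p a → At i (suc p) b →
                   Σ Phase λ r′ → Admissible r′ × DefenseMove (Melon k ℓ) (C r) (C r′) a b
    edge-defense {r} adm {i} {a = a} {b} a-at b-at with C r a in a∈ | C r b in b∈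
    ... | true  | true  =
      r , adm , transposeMove (Melon k ℓ) _≟ᵥ_ a b (At-adj a-at b-at) (At-adj⁻ a-at b-at) a∈ b∈
    ... | true  | false =
      let j , j≢i , ℓ≡ , opposite = partner adm i
          open RotationMove r i j (j≢i ∘ sym) ℓ≡ opposite
      in r′ , admissible adm , move (inj₁ (a∈ , answers-up a-at b-at b∈))
    ... | false | true  =
      let j , j≢i , ℓ≡ , opposite = partner adm i
          open RotationMove r j i j≢i (sym ℓ≡) (sym (⁻¹-selfInverse (sym opposite)))
      in r′ , admissible adm , move (inj₂ (b∈ , answers-down a-at b-at a∈))
    ... | false | false = [ (λ a∈′ → case trans (sym a∈′) a∈ of λ ())
                          , (λ b∈′ → case trans (sym b∈′) b∈ of λ ()) ]′
                          (C-cover r a b (At-adj a-at b-at))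

    𝒰-isEVCClass : ∀ o₁ o₂ → o₁ ≢ o₂ → parity (ℓ o₁) ≡ 1ℙ → parity (ℓ o₂) ≡ 1ℙ →
                   IsEVCClass (Melon k ℓ) (𝒰Family k ℓ) (suc coverNumber)
    𝒰-isEVCClass o₁ o₂ o₁≢o₂ o₁-odd o₂-odd =
      let r₀ , adm₀ = admissible-phase e₁ o₁ o₂ e₁-even o₁-odd o₂-odd o₁≢o₂ in
      lift (C r₀ , C∈𝒰 adm₀) , lift sizes , lift defend
      where
      sizes : ∀ U → 𝒰Family k ℓ U → IsVertexCover (Melon k ℓ) U × ∣_∣ₛ {Melon k ℓ} U ≡ suc coverNumber
      sizes U U∈𝒰 = let r , adm , U≗C = 𝒰⇒C U∈𝒰 in
        IsVertexCover-cong (Melon k ℓ) (sym ∘ U≗C) (C-cover r) ,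
        trans (count-cong U≗C (melonVertices k ℓ)) (size-C-admissible adm)
      defend : ∀ U → 𝒰Family k ℓ U → ∀ v w → MelonAdj k ℓ v w →
               DefenseInto (Melon k ℓ) (𝒰Family k ℓ) U v w
      defend U U∈𝒰 v w (i , p , vw) with 𝒰⇒C U∈𝒰 | vw
      ... | r , adm , U≗C | inj₁ (v-at , w-at) = let r′ , adm′ , m = edge-defense adm v-at w-at in
        DefenseMove.defenseInto (DefenseMove-cong (Melon k ℓ) (sym ∘ U≗C) m) (C∈𝒰 adm′)
      ... | r , adm , U≗C | inj₂ (w-at , v-at) = let r′ , adm′ , m = edge-defense adm w-at v-at in
        DefenseMove.defenseInto
          (DefenseMove-cong (Melon k ℓ) (sym ∘ U≗C) (DefenseMove-sym (Melon k ℓ) m)) (C∈𝒰 adm′)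

theorem13 : (k : ℕ) (ℓ : Fin k → ℕ) →
    4 ≤ k →
    (∀ i → 1 ≤ ℓ i) →
    (∀ i j → ℓ i ≡ 1 → ℓ j ≡ 1 → i ≡ j) →
    (Σ (Fin k) λ i → Σ (Fin k) λ j → i ≢ j × Even (ℓ i) × Even (ℓ j)) →
    (Σ (Fin k) λ i → Σ (Fin k) λ j → i ≢ j × Odd (ℓ i) × Odd (ℓ j)) →
    Σ ℕ λ c → IsVCNumber (Melon k ℓ) c ×
      IsEVCNumber (Melon k ℓ) (suc c) ×
      IsMinimumEVCClass (Melon k ℓ) (𝒰Family k ℓ) (suc c)
-- Melon k ℓ may have parallel s–t edges.
theorem13 k ℓ k≥4 ℓ≥1 _ (e₁ , e₂ , e₁≢e₂ , e₁-even , e₂-even) (o₁ , o₂ , o₁≢o₂ , o₁-odd , o₂-odd) =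
  coverNumber , isVCNumber k≥4 , evc , 𝒰-class , evc
  where
  open MelonGraph k ℓ ℓ≥1
  open TwoEvenPaths e₁ e₂ e₁≢e₂ (even⇒parity≡0ℙ e₁-even) (even⇒parity≡0ℙ e₂-even)
  𝒰-class : IsEVCClass (Melon k ℓ) (𝒰Family k ℓ) (suc coverNumber)
  𝒰-class = 𝒰-isEVCClass o₁ o₂ o₁≢o₂ (odd⇒parity≡1ℙ o₁-odd) (odd⇒parity≡1ℙ o₂-odd)
  evc : IsEVCNumber (Melon k ℓ) (suc coverNumber)
  evc = (𝒰Family k ℓ , 𝒰-class) , λ _ _ class → lift (evc-bound k≥4 class)
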